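{- Let $k\ge2$, let $U$ be any rotation of a binary de Bruijn sequence of order $k$, and let $w_{\mathrm{lin}}=U\,U[0..k-2]$. Then the size $\chi$ of a smallest suffixient set for $w_{\mathrm{lin}}\$$ is $2^k+1$.
   Context: A binary de Bruijn sequence of order $k$ is a cyclic word of length $2^k$ over $\{0,1\}$ whose $2^k$ cyclic length-$k$ windows are exactly all words of $\{0,1\}^k$, each occurring once. A rotation of a cyclic word is the linear word read from some starting position. Strings are 0-indexed and $w[i..j]$ denotes the substring from position $i$ to $j$ inclusive. $\$\notin\{0,1\}$ is an end-marker smaller than every letter; $w\$$ is $w$ followed by one $\$$, a string over $\{0,1,\$\}$. A substring $x$ of a string $w$ (possibly empty) is right-maximal if $xa$ and $xb$ are substrings of $w$ for some distinct letters $a\neq b$; right-extensions of $w$ are the substrings $xa$ with $x$ right-maximal. A set $S$ of positions of $w$ is suffixient if every right-extension of $w$ is a suffix of $w[0..j]$ for some $j\in S$. $\chi$ is the minimum size of a suffixient set of $w_{\mathrm{lin}}\$$. -}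

module Defs where

open import Data.Bool using (Bool; true; false)
open import Data.Nat using (ℕ; zero; suc; _+_; _∸_; _^_; _≤_; _<_)
open import Data.List using (List; []; _∷_; _++_; take; drop; length; map)
open import Data.Fin using (Fin; toℕ)
open import Data.Fin.Subset using (Subset; _∈_; ∣_∣)
open import Data.Product using (Σ; ∃; ∃-syntax; _×_; _,_; ∃!)
open import Relation.Binary.PropositionalEquality using (_≡_)
open import Relation.Nullary using (¬_)

CyclicWindow : ℕ → List Bool → ℕ → List Bool
CyclicWindow k U i = take k (drop i (U ++ U))

IsDeBruijn : ℕ → List Bool → Set
IsDeBruijn k U =
  length U ≡ 2 ^ k ×
  (∀ (x : List Bool) → length x ≡ k →
     ∃! _≡_ (λ (i : Fin (2 ^ k)) → CyclicWindow k U (toℕ i) ≡ x))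

IsRotationOf : List Bool → List Bool → Set
IsRotationOf U V = ∃[ j ] (j < length V × U ≡ drop j V ++ take j V)

data Sym : Set where
  $ : Sym
  c : Bool → Sym

withEnd : List Bool → List Sym
withEnd w = map c w ++ ($ ∷ [])

IsSubstring : List Sym → List Sym → Set
IsSubstring x w = ∃[ u ] ∃[ v ] (u ++ x ++ v ≡ w)

IsSuffix : List Sym → List Sym → Set
IsSuffix y w = ∃[ u ] (u ++ y ≡ w)

RightMaximal : List Sym → List Sym → Set
RightMaximal w x = ∃[ a ] ∃[ b ] (¬ a ≡ b ×
  IsSubstring (x ++ a ∷ []) w × IsSubstring (x ++ b ∷ []) w)

RightExtension : List Sym → List Sym → Set
RightExtension w y = ∃[ x ] ∃[ a ] (y ≡ x ++ a ∷ [] × RightMaximal w x × IsSubstring y w)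

Suffixient : (w : List Sym) → Subset (length w) → Set
Suffixient w S = ∀ y → RightExtension w y →
  ∃[ j ] (j ∈ S × IsSuffix y (take (suc (toℕ j)) w))

MinSuffixientSize : List Sym → ℕ → Set
MinSuffixientSize w m =
  (∃[ S ] (Suffixient w S × ∣ S ∣ ≡ m)) ×
  (∀ S → Suffixient w S → m ≤ ∣ S ∣)

-- Write k = m + 1, n = 2^k, W = w_lin and E = W$, so |E| = n + m + 1. The length-k windows of W
-- starting at 0, …, n − 1 are the cyclic windows of U, i.e. every binary word of length k exactly
-- once. Hence the window of E ending at any position t ≥ m occurs in E only there, and it is a
-- right-extension because its length-m prefix x has both x0 and x1 as windows of W; so every
-- suffixient set contains the n + 1 positions m, …, n + m. Conversely these positions suffice: an
-- occurrence ending before m lies in the prefix W[0..m-1], which reappears as the suffix before $.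
module Submission where

open import Data.Bool using (Bool; false; true)
open import Data.Empty using (⊥-elim)
open import Data.Fin using (Fin; toℕ; fromℕ<; suc)
open import Data.Fin.Properties using (toℕ<n; toℕ-fromℕ<; toℕ-injective)
open import Data.Fin.Subset using (Subset; _∈_; ∣_∣; ⊤; outside)
open import Data.Fin.Subset.Properties using (∈⊤; ∣⊤∣≡n; p⊆q⇒∣p∣≤∣q∣)
open import Data.List using (List; []; _∷_; _++_; take; drop; length; map)
open import Data.List.Properties
open import Data.List.Membership.Propositional using () renaming (_∈_ to _∈ₗ_)
open import Data.List.Membership.Propositional.Properties using (∈-map⁻; ∈-++⁺ʳ)
open import Data.List.Relation.Unary.Any using (here)
open import Data.Nat using (ℕ; zero; suc; _+_; _∸_; _^_; _≤_; _<_; z≤n; s≤s; z<s; _≤?_; NonZero)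
open import Data.Nat.DivMod using (_%_; %-distribˡ-+; m%n%n≡m%n; [m+n]%n≡m%n; m<n⇒m%n≡m; m%n<n)
open import Data.Nat.Properties
open import Data.Product using (∃-syntax; _×_; _,_)
open import Data.Sum using (inj₁; inj₂)
open import Data.Vec using ([]; _∷_; there)
open import Relation.Binary.PropositionalEquality
open import Relation.Nullary using (yes; no)
open import Defs

open ≡-Reasoning

module _ {A : Set} where

  drop-++ˡ : ∀ p (xs ys : List A) → p ≤ length xs → drop p (xs ++ ys) ≡ drop p xs ++ ys
  drop-++ˡ zero    xs       ys _         = refl
  drop-++ˡ (suc p) (x ∷ xs) ys (s≤s p≤) = drop-++ˡ p xs ys p≤

  take-++ˡ : ∀ k (xs ys : List A) → k ≤ length xs → take k (xs ++ ys) ≡ take k xs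
  take-++ˡ zero    xs       ys _         = refl
  take-++ˡ (suc k) (x ∷ xs) ys (s≤s k≤) = cong (x ∷_) (take-++ˡ k xs ys k≤)

  drop-length-++ : ∀ (xs ys : List A) → drop (length xs) (xs ++ ys) ≡ ys
  drop-length-++ []       ys = refl
  drop-length-++ (x ∷ xs) ys = drop-length-++ xs ys

  take-length-++ : ∀ (xs ys : List A) → take (length xs) (xs ++ ys) ≡ xs
  take-length-++ xs ys = trans (take-++ˡ (length xs) xs ys ≤-refl) (take-all (length xs) xs ≤-refl)

  length-take-≤ : ∀ k (xs : List A) → k ≤ length xs → length (take k xs) ≡ k
  length-take-≤ k xs k≤ = trans (length-take k xs) (m≤n⇒m⊓n≡m k≤)

  length-snoc : ∀ (xs : List A) x → length (xs ++ x ∷ []) ≡ suc (length xs)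
  length-snoc xs x = trans (length-++ xs) (+-comm (length xs) 1)

  length-++-snoc : ∀ (u xs : List A) x → length (u ++ xs ++ x ∷ []) ≡ suc (length u + length xs)
  length-++-snoc u xs x = trans (length-++ u) (trans (cong (length u +_) (length-snoc xs x)) (+-suc (length u) _))

  unsnoc-length : ∀ m (xs : List A) → length xs ≡ suc m →
                  ∃[ ys ] ∃[ y ] (xs ≡ ys ++ y ∷ [] × length ys ≡ m)
  unsnoc-length zero    (x ∷ [])  _   = [] , x , refl , refl
  unsnoc-length (suc m) (x ∷ xs) |xs| with unsnoc-length m xs (suc-injective |xs|)
  ... | ys , y , refl , refl = x ∷ ys , y , refl , refl

  ++-prefix : ∀ (xs ys zs ws : List A) → length xs ≤ length zs → xs ++ ys ≡ zs ++ ws →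
              xs ++ drop (length xs) zs ≡ zs
  ++-prefix xs ys zs ws |xs|≤ eq = begin
    xs ++ drop (length xs) zs                  ≡⟨ cong (_++ drop (length xs) zs) prefix ⟨
    take (length xs) zs ++ drop (length xs) zs ≡⟨ take++drop≡id (length xs) zs ⟩
    zs                                         ∎
    where
    prefix : take (length xs) zs ≡ xs
    prefix = begin
      take (length xs) zs         ≡⟨ take-++ˡ (length xs) zs ws |xs|≤ ⟨
      take (length xs) (zs ++ ws) ≡⟨ cong (take (length xs)) eq ⟨
      take (length xs) (xs ++ ys) ≡⟨ take-length-++ xs ys ⟩
      xs                          ∎

  drop-occurrence : ∀ (u y v : List A) {w} → u ++ y ++ v ≡ w → drop (length u) w ≡ y ++ v
  drop-occurrence u y v refl = drop-length-++ u (y ++ v)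

  occurrence-length : ∀ (u y v : List A) {w} → u ++ y ++ v ≡ w → length u + length y ≤ length w
  occurrence-length u y v refl =
    ≤-trans (+-monoʳ-≤ (length u) (m≤m+n (length y) (length v))) (≤-reflexive (sym |uyv|))
    where
    |uyv| : length (u ++ y ++ v) ≡ length u + (length y + length v)
    |uyv| = trans (length-++ u) (cong (length u +_) (length-++ y))

  rotate : ℕ → List A → List A
  rotate j xs = drop j xs ++ take j xs

  length-rotate : ∀ j (xs : List A) → length (rotate j xs) ≡ length xs
  length-rotate j xs = begin
    length (drop j xs ++ take j xs) ≡⟨ length-++-comm (drop j xs) (take j xs) ⟩
    length (take j xs ++ drop j xs) ≡⟨ cong length (take++drop≡id j xs) ⟩
    length xs                       ∎

  drop-rotate : ∀ j (xs : List A) → j ≤ length xs →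
                drop j (xs ++ xs ++ xs) ≡ (rotate j xs ++ rotate j xs) ++ drop j xs
  drop-rotate j xs j≤ = begin
    drop j (xs ++ xs ++ xs)          ≡⟨ drop-++ˡ j xs (xs ++ xs) j≤ ⟩
    R ++ xs ++ xs                    ≡⟨ cong (λ ys → R ++ ys ++ ys) (take++drop≡id j xs) ⟨
    R ++ (L ++ R) ++ (L ++ R)        ≡⟨ cong (R ++_) (++-assoc L R (L ++ R)) ⟩
    R ++ L ++ R ++ L ++ R            ≡⟨ ++-assoc R L (R ++ L ++ R) ⟨
    (R ++ L) ++ R ++ L ++ R          ≡⟨ cong ((R ++ L) ++_) (++-assoc R L R) ⟨
    (R ++ L) ++ (R ++ L) ++ R        ≡⟨ ++-assoc (R ++ L) (R ++ L) R ⟨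
    ((R ++ L) ++ (R ++ L)) ++ R      ∎
    where
    L = take j xs
    R = drop j xs

  window : ℕ → List A → ℕ → List A
  window k xs p = take k (drop p xs)

  length-drop-≥ : ∀ k p (xs : List A) → p + k ≤ length xs → k ≤ length (drop p xs)
  length-drop-≥ k p xs fits =
    subst₂ _≤_ (m+n∸m≡n p k) (sym (length-drop p xs)) (∸-monoˡ-≤ p fits)

  length-window : ∀ k p (xs : List A) → p + k ≤ length xs → length (window k xs p) ≡ k
  length-window k p xs fits = length-take-≤ k (drop p xs) (length-drop-≥ k p xs fits)

  window-++ˡ : ∀ k p (xs ys : List A) → p + k ≤ length xs → window k (xs ++ ys) p ≡ window k xs p
  window-++ˡ k p xs ys fits = begin
    take k (drop p (xs ++ ys)) ≡⟨ cong (take k) (drop-++ˡ p xs ys (≤-trans (m≤m+n p k) fits)) ⟩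
    take k (drop p xs ++ ys)   ≡⟨ take-++ˡ k (drop p xs) ys (length-drop-≥ k p xs fits) ⟩
    take k (drop p xs)         ∎

  window-cycle : ∀ k (xs : List A) .{{_ : NonZero (length xs)}} → k ≤ length xs →
                 ∀ {b} → b < length xs + length xs →
                 window k (xs ++ xs ++ xs) b ≡ window k (xs ++ xs) (b % length xs)
  window-cycle k xs k≤n {b} b<2n with b <? length xs
  ... | yes b<n = begin
    window k (xs ++ xs ++ xs) b   ≡⟨ cong (λ ys → window k ys b) (++-assoc xs xs xs) ⟨
    window k ((xs ++ xs) ++ xs) b ≡⟨ window-++ˡ k b (xs ++ xs) xs fits ⟩
    window k (xs ++ xs) b         ≡⟨ cong (window k (xs ++ xs)) (m<n⇒m%n≡m b<n) ⟨
    window k (xs ++ xs) (b % length xs) ∎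
    where
    fits : b + k ≤ length (xs ++ xs)
    fits = subst (b + k ≤_) (sym (length-++ xs)) (+-mono-≤ (<⇒≤ b<n) k≤n)
  ... | no b≮n = begin
    window k (xs ++ xs ++ xs) b          ≡⟨ cong (window k (xs ++ xs ++ xs)) (m+[n∸m]≡n n≤b) ⟨
    window k (xs ++ xs ++ xs) (n + d)    ≡⟨ cong (take k) (drop-drop n d (xs ++ xs ++ xs)) ⟨
    window k (drop n (xs ++ xs ++ xs)) d ≡⟨ cong (λ ys → window k ys d) (drop-length-++ xs (xs ++ xs)) ⟩
    window k (xs ++ xs) d                ≡⟨ cong (window k (xs ++ xs)) d≡b%n ⟩
    window k (xs ++ xs) (b % n)          ∎
    where
    n = length xs
    n≤b = ≮⇒≥ b≮n
    d = b ∸ n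
    d≡b%n : d ≡ b % n
    d≡b%n = begin
      d           ≡⟨ m<n⇒m%n≡m (subst (d <_) (m+n∸n≡m n n) (∸-monoˡ-< b<2n n≤b)) ⟨
      d % n       ≡⟨ [m+n]%n≡m%n d n ⟨
      (d + n) % n ≡⟨ cong (_% n) (m∸n+n≡m n≤b) ⟩
      b % n       ∎

record WindowsEnumerate {A : Set} (k n : ℕ) (w : List A) : Set where
  field
    cover    : ∀ x → length x ≡ k → ∃[ p ] (p < n × window k w p ≡ x)
    distinct : ∀ {p q} → p < n → q < n → window k w p ≡ window k w q → p ≡ q

WindowsEnumerate-reindex : ∀ {A : Set} {k n} {w w′ : List A} (σ τ : ℕ → ℕ) →
  (∀ {p} → p < n → σ p < n) → (∀ {a} → a < n → τ a < n) →
  (∀ {p} → p < n → τ (σ p) ≡ p) → (∀ {a} → a < n → σ (τ a) ≡ a) →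
  (∀ {p} → p < n → window k w′ p ≡ window k w (σ p)) →
  WindowsEnumerate k n w → WindowsEnumerate k n w′
WindowsEnumerate-reindex {k = k} {n} {w} {w′} σ τ σ<n τ<n τσ≗id στ≗id window′≡ enum =
  record { cover = cover′ ; distinct = distinct′ }
  where
  open WindowsEnumerate enum
  cover′ : ∀ x → length x ≡ k → ∃[ p ] (p < n × window k w′ p ≡ x)
  cover′ x |x| with cover x |x|
  ... | a , a<n , eq = τ a , τ<n a<n , trans (window′≡ (τ<n a<n)) (trans (cong (window k w) (στ≗id a<n)) eq)
  distinct′ : ∀ {p q} → p < n → q < n → window k w′ p ≡ window k w′ q → p ≡ q
  distinct′ {p} {q} p<n q<n eq = begin
    p       ≡⟨ τσ≗id p<n ⟨
    τ (σ p) ≡⟨ cong τ (distinct (σ<n p<n) (σ<n q<n) σ-eq) ⟩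
    τ (σ q) ≡⟨ τσ≗id q<n ⟩
    q       ∎
    where
    σ-eq : window k w (σ p) ≡ window k w (σ q)
    σ-eq = trans (sym (window′≡ p<n)) (trans eq (window′≡ q<n))

n<2^n : ∀ n → n < 2 ^ n
n<2^n zero    = z<s
n<2^n (suc n) = +-mono-≤ (m^n>0 2 n) (≤-trans (n<2^n n) (m≤m+n (2 ^ n) 0))

isDeBruijn⇒WindowsEnumerate : ∀ {k} {V : List Bool} → IsDeBruijn k V → WindowsEnumerate k (2 ^ k) (V ++ V)
isDeBruijn⇒WindowsEnumerate {k} {V} (|V| , unique) = record { cover = cover ; distinct = distinct }
  where
  cover : ∀ x → length x ≡ k → ∃[ p ] (p < 2 ^ k × window k (V ++ V) p ≡ x)
  cover x |x| with unique x |x|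
  ... | i , i-window , _ = toℕ i , toℕ<n i , i-window
  distinct : ∀ {p q} → p < 2 ^ k → q < 2 ^ k → window k (V ++ V) p ≡ window k (V ++ V) q → p ≡ q
  distinct {p} {q} p<n q<n eq with unique (window k (V ++ V) p) (length-window k p (V ++ V) fits)
    where
    fits : p + k ≤ length (V ++ V)
    fits = subst (p + k ≤_) (sym (trans (length-++ V) (cong₂ _+_ |V| |V|)))
                 (+-mono-≤ (<⇒≤ p<n) (<⇒≤ (n<2^n k)))
  ... | _ , _ , minimal = begin
    p                ≡⟨ toℕ-fromℕ< p<n ⟨
    toℕ (fromℕ< p<n) ≡⟨ cong toℕ (trans (sym (minimal (at p<n refl))) (minimal (at q<n (sym eq)))) ⟩
    toℕ (fromℕ< q<n) ≡⟨ toℕ-fromℕ< q<n ⟩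
    q                ∎
    where
    at : ∀ {r} (r<n : r < 2 ^ k) → window k (V ++ V) r ≡ window k (V ++ V) p →
         CyclicWindow k V (toℕ (fromℕ< r<n)) ≡ window k (V ++ V) p
    at r<n eq′ = trans (cong (window k (V ++ V)) (toℕ-fromℕ< r<n)) eq′

%-rotate-inverse : ∀ {j a n} .{{_ : NonZero n}} → j ≤ n → a < n → (j + (n ∸ j + a) % n) % n ≡ a
%-rotate-inverse {j} {a} {n} j≤n a<n = begin
  (j + (n ∸ j + a) % n) % n         ≡⟨ %-distribˡ-+ j _ n ⟩
  (j % n + (n ∸ j + a) % n % n) % n ≡⟨ cong (λ i → (j % n + i) % n) (m%n%n≡m%n _ n) ⟩
  (j % n + (n ∸ j + a) % n) % n     ≡⟨ %-distribˡ-+ j (n ∸ j + a) n ⟨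
  (j + (n ∸ j + a)) % n             ≡⟨ cong (_% n) j+[n∸j+a]≡a+n ⟩
  (a + n) % n                       ≡⟨ [m+n]%n≡m%n a n ⟩
  a % n                             ≡⟨ m<n⇒m%n≡m a<n ⟩
  a                                 ∎
  where
  j+[n∸j+a]≡a+n : j + (n ∸ j + a) ≡ a + n
  j+[n∸j+a]≡a+n = trans (sym (+-assoc j (n ∸ j) a)) (trans (cong (_+ a) (m+[n∸m]≡n j≤n)) (+-comm n a))

module _ {A : Set} where

  window-rotate : ∀ k j (xs : List A) .{{_ : NonZero (length xs)}} → k ≤ length xs → j ≤ length xs →
                  ∀ {p} → p < length xs →
                  window k (rotate j xs ++ rotate j xs) p ≡ window k (xs ++ xs) ((j + p) % length xs)
  window-rotate k j xs k≤n j≤n {p} p<n = begin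
    window k (U ++ U) p                   ≡⟨ window-++ˡ k p (U ++ U) (drop j xs) fits ⟨
    window k ((U ++ U) ++ drop j xs) p    ≡⟨ cong (λ ys → window k ys p) (drop-rotate j xs j≤n) ⟨
    window k (drop j (xs ++ xs ++ xs)) p  ≡⟨ cong (take k) (drop-drop j p (xs ++ xs ++ xs)) ⟩
    window k (xs ++ xs ++ xs) (j + p)     ≡⟨ window-cycle k xs k≤n (+-mono-≤-< j≤n p<n) ⟩
    window k (xs ++ xs) ((j + p) % length xs) ∎
    where
    U = rotate j xs
    fits : p + k ≤ length (U ++ U)
    fits = subst (p + k ≤_) (sym (trans (length-++ U) (cong₂ _+_ (length-rotate j xs) (length-rotate j xs))))
                 (+-mono-≤ (<⇒≤ p<n) k≤n)

  WindowsEnumerate-rotate : ∀ {k n j} {xs : List A} .{{_ : NonZero n}} → length xs ≡ n → k ≤ n → j ≤ n →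
                            WindowsEnumerate k n (xs ++ xs) → WindowsEnumerate k n (rotate j xs ++ rotate j xs)
  WindowsEnumerate-rotate {k} {n} {j} {xs} refl k≤n j≤n =
    WindowsEnumerate-reindex (λ p → (j + p) % n) (λ a → (n ∸ j + a) % n)
      (λ _ → m%n<n _ n) (λ _ → m%n<n _ n) τσ≗id (%-rotate-inverse j≤n) (window-rotate k j xs k≤n j≤n)
    where
    τσ≗id : ∀ {p} → p < n → (n ∸ j + (j + p) % n) % n ≡ p
    τσ≗id {p} p<n = subst (λ i → (n ∸ j + (i + p) % n) % n ≡ p) (m∸[m∸n]≡n j≤n)
                          (%-rotate-inverse (m∸n≤m n j) p<n)

  WindowsEnumerate-linearise : ∀ {m n} {xs : List A} → length xs ≡ n → m ≤ n →
                               WindowsEnumerate (suc m) n (xs ++ xs) → WindowsEnumerate (suc m) n (xs ++ take m xs)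
  WindowsEnumerate-linearise {m} {n} {xs} |xs| m≤n =
    WindowsEnumerate-reindex (λ p → p) (λ a → a) (λ p<n → p<n) (λ a<n → a<n) (λ _ → refl) (λ _ → refl)
      window≡
    where
    window≡ : ∀ {p} → p < n → window (suc m) (xs ++ take m xs) p ≡ window (suc m) (xs ++ xs) p
    window≡ {p} p<n = begin
      window (suc m) (xs ++ take m xs) p                    ≡⟨ window-++ˡ (suc m) p _ (drop m xs) fits ⟨
      window (suc m) ((xs ++ take m xs) ++ drop m xs) p     ≡⟨ cong (λ ys → window (suc m) ys p) split ⟩
      window (suc m) (xs ++ xs) p                           ∎
      where
      split : (xs ++ take m xs) ++ drop m xs ≡ xs ++ xs
      split = trans (++-assoc xs (take m xs) (drop m xs)) (cong (xs ++_) (take++drop≡id m xs))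
      |xs++take| : length (xs ++ take m xs) ≡ n + m
      |xs++take| = trans (length-++ xs) (cong₂ _+_ |xs| (length-take-≤ m xs (subst (m ≤_) (sym |xs|) m≤n)))
      fits : p + suc m ≤ length (xs ++ take m xs)
      fits = subst₂ _≤_ (sym (+-suc p m)) (sym |xs++take|) (+-monoˡ-≤ m p<n)

length-withEnd : ∀ w → length (withEnd w) ≡ suc (length w)
length-withEnd w = trans (length-snoc (map c w) $) (cong suc (length-map c w))

drop-withEnd : ∀ p w → p ≤ length w → drop p (withEnd w) ≡ withEnd (drop p w)
drop-withEnd p w p≤ = begin
  drop p (map c w ++ $ ∷ [])   ≡⟨ drop-++ˡ p (map c w) ($ ∷ []) p≤|map-c-w| ⟩
  drop p (map c w) ++ $ ∷ []   ≡⟨ cong (_++ $ ∷ []) (drop-map p w) ⟩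
  map c (drop p w) ++ $ ∷ []   ∎
  where
  p≤|map-c-w| : p ≤ length (map c w)
  p≤|map-c-w| = ≤-trans p≤ (≤-reflexive (sym (length-map c w)))

window-withEnd : ∀ k p w → p + k ≤ length w → window k (withEnd w) p ≡ map c (window k w p)
window-withEnd k p w fits = begin
  take k (drop p (withEnd w))         ≡⟨ cong (take k) (drop-withEnd p w (≤-trans (m≤m+n p k) fits)) ⟩
  take k (map c (drop p w) ++ $ ∷ []) ≡⟨ take-++ˡ k _ ($ ∷ []) k≤ ⟩
  take k (map c (drop p w))           ≡⟨ take-map k (drop p w) ⟩
  map c (take k (drop p w))           ∎
  where
  k≤ : k ≤ length (map c (drop p w))
  k≤ = subst (k ≤_) (sym (length-map c (drop p w))) (length-drop-≥ k p w fits)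

window-withEnd-last : ∀ m p w → p + m ≡ length w → window (suc m) (withEnd w) p ≡ withEnd (drop p w)
window-withEnd-last m p w p+m≡ = begin
  take (suc m) (drop p (withEnd w)) ≡⟨ cong (take (suc m)) (drop-withEnd p w p≤|w|) ⟩
  take (suc m) (withEnd (drop p w)) ≡⟨ take-all (suc m) _ (≤-reflexive |withEnd|) ⟩
  withEnd (drop p w)                ∎
  where
  p≤|w| : p ≤ length w
  p≤|w| = ≤-trans (m≤m+n p m) (≤-reflexive p+m≡)
  |withEnd| : length (withEnd (drop p w)) ≡ suc m
  |withEnd| = begin
    length (withEnd (drop p w)) ≡⟨ length-withEnd (drop p w) ⟩
    suc (length (drop p w))     ≡⟨ cong suc (length-drop p w) ⟩
    suc (length w ∸ p)          ≡⟨ cong (λ l → suc (l ∸ p)) p+m≡ ⟨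
    suc (p + m ∸ p)             ≡⟨ cong suc (m+n∸m≡n p m) ⟩
    suc m                       ∎

window-isSubstring : ∀ k p w → IsSubstring (window k w p) w
window-isSubstring k p w = take p w , drop k (drop p w) , (begin
  take p w ++ take k (drop p w) ++ drop k (drop p w) ≡⟨ cong (take p w ++_) (take++drop≡id k (drop p w)) ⟩
  take p w ++ drop p w                               ≡⟨ take++drop≡id p w ⟩
  w                                                  ∎)

withEnd≢map-c : ∀ w x → withEnd w ≢ map c x
withEnd≢map-c w x eq with ∈-map⁻ c (subst ($ ∈ₗ_) eq (∈-++⁺ʳ (map c w) (here refl)))
... | _ , _ , ()

atLeast : ∀ M → ℕ → Subset M
atLeast M       zero    = ⊤
atLeast zero    (suc d) = []
atLeast (suc M) (suc d) = outside ∷ atLeast M d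

∣atLeast∣ : ∀ M d → ∣ atLeast M d ∣ ≡ M ∸ d
∣atLeast∣ M       zero    = ∣⊤∣≡n M
∣atLeast∣ zero    (suc d) = refl
∣atLeast∣ (suc M) (suc d) = ∣atLeast∣ M d

∈-atLeast⁺ : ∀ {M d} (t : Fin M) → d ≤ toℕ t → t ∈ atLeast M d
∈-atLeast⁺ {d = zero}          t       _         = ∈⊤
∈-atLeast⁺ {suc M} {suc d} (suc t) (s≤s d≤t) = there (∈-atLeast⁺ t d≤t)

∈-atLeast⁻ : ∀ {M d} (t : Fin M) → t ∈ atLeast M d → d ≤ toℕ t
∈-atLeast⁻ {d = zero}      t       _         = z≤n
∈-atLeast⁻ {suc M} {suc d} (suc t) (there t∈) = s≤s (∈-atLeast⁻ t t∈)

occurrence-suffix : ∀ d (u x v w : List Sym) a → u ++ (x ++ a ∷ []) ++ v ≡ w → d ≤ length u + length x →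
                    ∃[ j ] (j ∈ atLeast (length w) d × IsSuffix (x ++ a ∷ []) (take (suc (toℕ j)) w))
occurrence-suffix d u x v w a occ d≤ =
  fromℕ< end<|w| , ∈-atLeast⁺ _ (subst (d ≤_) (sym (toℕ-fromℕ< end<|w|)) d≤) , u , suffix
  where
  y = x ++ a ∷ []
  end<|w| : length u + length x < length w
  end<|w| = subst (_≤ length w) (trans (sym (length-++ u)) (length-++-snoc u x a)) (occurrence-length u y v occ)
  suffix : u ++ y ≡ take (suc (toℕ (fromℕ< end<|w|))) w
  suffix = begin
    u ++ y                                   ≡⟨ take-length-++ (u ++ y) v ⟨
    take (length (u ++ y)) ((u ++ y) ++ v)   ≡⟨ cong₂ take (length-++-snoc u x a) (trans (++-assoc u y v) occ) ⟩
    take (suc (length u + length x)) w       ≡⟨ cong (λ i → take (suc i) w) (toℕ-fromℕ< end<|w|) ⟨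
    take (suc (toℕ (fromℕ< end<|w|))) w      ∎

module _ (m n : ℕ) (U : List Bool) (|U| : length U ≡ n) (m≤n : m ≤ n)
         (enum : WindowsEnumerate (suc m) n (U ++ take m U)) where

  private
    k = suc m
    T = take m U
    W = U ++ T
    E = withEnd W
  open WindowsEnumerate enum

  |T| : length T ≡ m
  |T| = length-take-≤ m U (subst (m ≤_) (sym |U|) m≤n)

  |W| : length W ≡ n + m
  |W| = trans (length-++ U) (cong₂ _+_ |U| |T|)

  |E| : length E ≡ suc (n + m)
  |E| = trans (length-withEnd W) (cong suc |W|)

  window-fits : ∀ {p} → p ≤ n → p + k ≤ length E
  window-fits {p} p≤n = subst₂ _≤_ (sym (+-suc p m)) (sym |E|) (s≤s (+-monoˡ-≤ m p≤n))

  length-E-window : ∀ {p} → p ≤ n → length (window k E p) ≡ k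
  length-E-window {p} p≤n = length-window k p E (window-fits p≤n)

  E-window-< : ∀ {p} → p < n → window k E p ≡ map c (window k W p)
  E-window-< {p} p<n = window-withEnd k p W (subst₂ _≤_ (sym (+-suc p m)) (sym |W|) (+-monoˡ-≤ m p<n))

  E-window-n : window k E n ≡ withEnd T
  E-window-n = trans (window-withEnd-last m n W (sym |W|)) (cong withEnd drop-n-W)
    where
    drop-n-W : drop n W ≡ T
    drop-n-W = subst (λ i → drop i W ≡ T) |U| (drop-length-++ U T)

  -- Only the last window contains $.
  E-window-injective : ∀ {p q} → p ≤ n → q ≤ n → window k E p ≡ window k E q → p ≡ q
  E-window-injective p≤n q≤n eq with m≤n⇒m<n∨m≡n p≤n | m≤n⇒m<n∨m≡n q≤n
  ... | inj₁ p<n  | inj₁ q<n  =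
    distinct p<n q<n (map-injective (λ { refl → refl }) (trans (sym (E-window-< p<n)) (trans eq (E-window-< q<n))))
  ... | inj₁ p<n  | inj₂ refl =
    ⊥-elim (withEnd≢map-c T _ (trans (sym E-window-n) (trans (sym eq) (E-window-< p<n))))
  ... | inj₂ refl | inj₁ q<n  =
    ⊥-elim (withEnd≢map-c T _ (trans (sym E-window-n) (trans eq (E-window-< q<n))))
  ... | inj₂ refl | inj₂ refl = refl

  E-window-split : ∀ {p} → p ≤ n → ∃[ x ] ∃[ a ] (window k E p ≡ map c x ++ a ∷ [] × length x ≡ m)
  E-window-split {p} p≤n with m≤n⇒m<n∨m≡n p≤n
  ... | inj₂ refl = T , $ , E-window-n , |T|
  ... | inj₁ p<n with unsnoc-length m (window k W p) (length-W-window p<n)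
    where
    length-W-window : p < n → length (window k W p) ≡ k
    length-W-window p<n = begin
      length (window k W p)         ≡⟨ length-map c (window k W p) ⟨
      length (map c (window k W p)) ≡⟨ cong length (E-window-< p<n) ⟨
      length (window k E p)         ≡⟨ length-E-window p≤n ⟩
      k                             ∎
  ...   | x , b , eq , |x| = x , c b , trans (E-window-< p<n) (trans (cong (map c) eq) (map-++ c x (b ∷ []))) , |x|

  E-contains-words : ∀ x → length x ≡ k → IsSubstring (map c x) E
  E-contains-words x |x| with cover x |x|
  ... | p , p<n , eq =
    subst (λ y → IsSubstring y E) (trans (E-window-< p<n) (cong (map c) eq)) (window-isSubstring k p E)

  rightMaximal-words : ∀ x → length x ≡ m → RightMaximal E (map c x)
  rightMaximal-words x |x| = c false , c true , (λ ()) , extension false , extension true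
    where
    extension : ∀ b → IsSubstring (map c x ++ c b ∷ []) E
    extension b = subst (λ y → IsSubstring y E) (map-++ c x (b ∷ []))
                        (E-contains-words (x ++ b ∷ []) (trans (length-snoc x b) (cong suc |x|)))

  E-window-rightExtension : ∀ {p} → p ≤ n → RightExtension E (window k E p)
  E-window-rightExtension {p} p≤n with E-window-split p≤n
  ... | x , a , eq , |x| = map c x , a , eq , rightMaximal-words x |x| , window-isSubstring k p E

  E-window-occurrence : ∀ {p} u v → p ≤ n → u ++ window k E p ++ v ≡ E → length u ≡ p
  E-window-occurrence {p} u v p≤n occ = E-window-injective |u|≤n p≤n window≡
    where
    y = window k E p
    |u|≤n : length u ≤ n
    |u|≤n = +-cancelʳ-≤ k (length u) n
              (subst₂ _≤_ (cong (length u +_) (length-E-window p≤n)) (trans |E| (sym (+-suc n m)))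
                      (occurrence-length u y v occ))
    window≡ : window k E (length u) ≡ y
    window≡ = begin
      take k (drop (length u) E) ≡⟨ cong (take k) (drop-occurrence u y v occ) ⟩
      take k (y ++ v)            ≡⟨ cong (λ i → take i (y ++ v)) (length-E-window p≤n) ⟨
      take (length y) (y ++ v)   ≡⟨ take-length-++ y v ⟩
      y                          ∎

  suffixient-contains : ∀ S → Suffixient E S → (t : Fin (length E)) → m ≤ toℕ t → t ∈ S
  suffixient-contains S suffixient t m≤t = endsAt-t (suffixient y (E-window-rightExtension p≤n))
    where
    p = toℕ t ∸ m
    p≤n : p ≤ n
    p≤n = subst (p ≤_) (m+n∸n≡m n m) (∸-monoˡ-≤ m (≤-pred (subst (toℕ t <_) |E| (toℕ<n t))))
    y = window k E p
    endsAt-t : ∃[ j ] (j ∈ S × IsSuffix y (take (suc (toℕ j)) E)) → t ∈ S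
    endsAt-t (j , j∈S , u , suffix) = subst (_∈ S) (toℕ-injective (suc-injective end≡)) j∈S
      where
      occ : u ++ y ++ drop (suc (toℕ j)) E ≡ E
      occ = trans (sym (++-assoc u y _)) (trans (cong (_++ _) suffix) (take++drop≡id (suc (toℕ j)) E))
      end≡ : suc (toℕ j) ≡ suc (toℕ t)
      end≡ = begin
        suc (toℕ j)                     ≡⟨ length-take-≤ _ E (toℕ<n j) ⟨
        length (take (suc (toℕ j)) E)   ≡⟨ cong length suffix ⟨
        length (u ++ y)                 ≡⟨ length-++ u ⟩
        length u + length y             ≡⟨ cong₂ _+_ (E-window-occurrence u _ p≤n occ) (length-E-window p≤n) ⟩
        p + suc m                       ≡⟨ +-suc p m ⟩
        suc (p + m)                     ≡⟨ cong suc (m∸n+n≡m m≤t) ⟩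
        suc (toℕ t)                     ∎

  ∣atLeast-m∣ : ∣ atLeast (length E) m ∣ ≡ n + 1
  ∣atLeast-m∣ = begin
    ∣ atLeast (length E) m ∣ ≡⟨ ∣atLeast∣ (length E) m ⟩
    length E ∸ m             ≡⟨ cong (_∸ m) |E| ⟩
    suc n + m ∸ m            ≡⟨ m+n∸n≡m (suc n) m ⟩
    suc n                    ≡⟨ +-comm 1 n ⟩
    n + 1                    ∎

  suffixient-size : ∀ S → Suffixient E S → n + 1 ≤ ∣ S ∣
  suffixient-size S suffixient = subst (_≤ ∣ S ∣) ∣atLeast-m∣
    (p⊆q⇒∣p∣≤∣q∣ (λ {t} t∈ → suffixient-contains S suffixient t (∈-atLeast⁻ t t∈)))

  E-late-occurrence : ∀ u x a v → u ++ (x ++ a ∷ []) ++ v ≡ E →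
                      ∃[ u′ ] ∃[ v′ ] (u′ ++ (x ++ a ∷ []) ++ v′ ≡ E × m ≤ length u′ + length x)
  E-late-occurrence u x a v occ with m ≤? length u + length x
  ... | yes late  = u , v , occ , late
  ... | no  early = map c U ++ u , z ++ $ ∷ [] , shifted , late
    where
    y = x ++ a ∷ []
    z = drop (length (u ++ y)) (map c T)
    E≡U++T$ : E ≡ map c U ++ withEnd T
    E≡U++T$ = trans (cong (_++ $ ∷ []) (map-++ c U T)) (++-assoc (map c U) (map c T) ($ ∷ []))
    E≡T++ : E ≡ map c T ++ map c (drop m U) ++ withEnd T
    E≡T++ = begin
      E                                               ≡⟨ E≡U++T$ ⟩
      map c U ++ withEnd T                            ≡⟨ cong (λ l → map c l ++ withEnd T) (take++drop≡id m U) ⟨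
      map c (T ++ drop m U) ++ withEnd T              ≡⟨ cong (_++ withEnd T) (map-++ c T (drop m U)) ⟩
      (map c T ++ map c (drop m U)) ++ withEnd T      ≡⟨ ++-assoc (map c T) _ _ ⟩
      map c T ++ map c (drop m U) ++ withEnd T        ∎
    |uy|≤m : length (u ++ y) ≤ length (map c T)
    |uy|≤m = subst₂ _≤_ (sym (length-++-snoc u x a)) (sym (trans (length-map c T) |T|)) (≰⇒> early)
    inT : u ++ y ++ z ≡ map c T
    inT = trans (sym (++-assoc u y z))
                (++-prefix (u ++ y) v (map c T) _ |uy|≤m (trans (++-assoc u y v) (trans occ E≡T++)))
    reassoc : (u ++ y ++ z) ++ $ ∷ [] ≡ u ++ y ++ z ++ $ ∷ []
    reassoc = trans (++-assoc u (y ++ z) _) (cong (u ++_) (++-assoc y z _))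
    shifted : (map c U ++ u) ++ y ++ z ++ $ ∷ [] ≡ E
    shifted = begin
      (map c U ++ u) ++ y ++ z ++ $ ∷ []  ≡⟨ ++-assoc (map c U) u _ ⟩
      map c U ++ u ++ y ++ z ++ $ ∷ []    ≡⟨ cong (map c U ++_) reassoc ⟨
      map c U ++ (u ++ y ++ z) ++ $ ∷ []  ≡⟨ cong (λ l → map c U ++ l ++ $ ∷ []) inT ⟩
      map c U ++ withEnd T                ≡⟨ E≡U++T$ ⟨
      E                                   ∎
    late : m ≤ length (map c U ++ u) + length x
    late = ≤-trans m≤n (subst (n ≤_) (cong (_+ length x) |Uu|)
                             (≤-trans (m≤m+n n (length u)) (m≤m+n _ (length x))))
      where
      |Uu| : n + length u ≡ length (map c U ++ u)
      |Uu| = sym (trans (length-++ (map c U)) (cong (_+ length u) (trans (length-map c U) |U|)))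

  atLeast-suffixient : Suffixient E (atLeast (length E) m)
  atLeast-suffixient y (x , a , refl , _ , u , v , occ) with E-late-occurrence u x a v occ
  ... | u′ , v′ , occ′ , late = occurrence-suffix m u′ x v′ E a occ′ late

  linearisedDeBruijn-minSuffixientSize : MinSuffixientSize E (n + 1)
  linearisedDeBruijn-minSuffixientSize = (atLeast (length E) m , atLeast-suffixient , ∣atLeast-m∣) , suffixient-size

lemma4 : (k : ℕ) → 2 ≤ k → (V U : List Bool) → IsDeBruijn k V → IsRotationOf U V →
    MinSuffixientSize (withEnd (U ++ take (k ∸ 1) U)) (2 ^ k + 1)
-- The hypothesis 2 ≤ k only excludes k = 0; the argument is uniform in k = suc m.
lemma4 (suc m) _ V _ deBruijn@(|V| , _) (j , j<n , refl) =
  linearisedDeBruijn-minSuffixientSize m n (rotate j V) |U| m≤n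
    (WindowsEnumerate-linearise |U| m≤n
      (WindowsEnumerate-rotate {{m^n≢0 2 (suc m)}} |V| k≤n (<⇒≤ (subst (j <_) |V| j<n))
        (isDeBruijn⇒WindowsEnumerate {V = V} deBruijn)))
  where
  n = 2 ^ suc m
  k≤n : suc m ≤ n
  k≤n = <⇒≤ (n<2^n (suc m))
  m≤n : m ≤ n
  m≤n = ≤-trans (n≤1+n m) k≤n
  |U| : length (rotate j V) ≡ n
  |U| = trans (length-rotate j V) |V|
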